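{- Let $G=(V,E)$ be a connected graph and let $\widehat{G}=(V,E\cup F)$ be an augmentation of $G$ with $F\cap E=\emptyset$. Let $A\subseteq 2^V$ be a collection of pairwise disjoint node sets such that for every $U\in A$ the subgraph $G[U]$ of $G$ induced by $U$ is connected, and let $x^A\in\{0,1\}^{E\cup F}$ be defined by: for all $uw\in E\cup F$, $x^A_{uw}=0$ if and only if there exists $U\in A$ with $\{u,w\}\subseteq U$. Then $x^A\in X_{G\widehat{G}}$.
   Context: For distinct nodes $u,w$ we write $uw$ for the set $\{u,w\}$. Given a connected graph $G=(V,E)$ and $\widehat G=(V,E\cup F)$ with $F\cap E=\emptyset$, $X_{G\widehat{G}}$ is the set of all $x\in\{0,1\}^{E\cup F}$ satisfying: (i) for every cycle $C$ of $G$ with edge set $E_C$ and every $e\in E_C$: $x_e\le\sum_{e'\in E_C\setminus\{e\}}x_{e'}$; (ii) for every $uw\in F$ and every $uw$-path $P$ in $G$ with edge set $E_P$: $x_{uw}\le\sum_{e\in E_P}x_e$; (iii) for every $uw\in F$ and every $uw$-cut $\delta$ of $G$: $1-x_{uw}\le\sum_{e\in\delta}(1-x_e)$. Here a $uw$-cut of $G$ is a set of edges $\delta=\{st\in E: |\{s,t\}\cap U|=1\}$ for some $U\subseteq V$ with $u\in U$, $w\notin U$. (Equivalently, $X_{G\widehat G}$ consists of those $x$ for which there is a decomposition $\Pi$ of $G$—a partition of $V$ into sets inducing connected subgraphs—such that $x_{uw}=0$ iff $u,w$ lie in a common block of $\Pi$, for all $uw\in E\cup F$.) -}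

module Defs where

open import Data.Nat using (ℕ; zero; suc; _∸_; _≤_; _<ᵇ_)
open import Data.Bool using (Bool; true; false; _∧_; _∨_; _xor_; not; if_then_else_)
open import Data.Fin using (Fin; toℕ)
open import Data.List using (List; []; _∷_; _++_; [_]; map; length; allFin; head; last; concatMap; filterᵇ)
open import Data.Nat.ListAction using (sum)
open import Data.Bool.ListAction using (any)
open import Data.List.Relation.Unary.All using (All)
open import Data.List.Relation.Unary.Linked using (Linked)
open import Data.List.Relation.Unary.Unique.Propositional using (Unique)
open import Data.Maybe using (Maybe; just)
open import Data.Product using (Σ; ∃; _×_; _,_; proj₁; proj₂)
open import Relation.Binary.PropositionalEquality using (_≡_; _≢_)

-- Graphs on the node set V = Fin n are given by a Bool-valued adjacency
-- relation on ordered pairs; an (unordered) edge uw is present iff E u w ≡ true.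
Rel : ℕ → Set
Rel n = Fin n → Fin n → Bool

SimpleGraph : ∀ {n} → Rel n → Set
SimpleGraph {n} E = (∀ (u w : Fin n) → E u w ≡ E w u) × (∀ (u : Fin n) → E u u ≡ false)

EdgeDisjoint : ∀ {n} → Rel n → Rel n → Set
EdgeDisjoint {n} E F = ∀ (u w : Fin n) → E u w ≡ true → F u w ≡ false

val : Bool → ℕ
val true = 1
val false = 0

pairs : ∀ {n} → List (Fin n) → List (Fin n × Fin n)
pairs [] = []
pairs (v ∷ []) = []
pairs (v ∷ w ∷ vs) = (v , w) ∷ pairs (w ∷ vs)

Adj : ∀ {n} → Rel n → Fin n → Fin n → Set
Adj E v w = E v w ≡ true

IsPath : ∀ {n} → Rel n → Fin n → Fin n → List (Fin n) → Set
IsPath E u w vs = (head vs ≡ just u) × (last vs ≡ just w) × Unique vs × Linked (Adj E) vs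

IsCycle : ∀ {n} → Rel n → Fin n → List (Fin n) → Set
IsCycle E v vs = (2 ≤ length vs) × Unique (v ∷ vs) × Linked (Adj E) (v ∷ vs ++ [ v ])

cycleEdges : ∀ {n} → Fin n → List (Fin n) → List (Fin n × Fin n)
cycleEdges v vs = pairs (v ∷ vs ++ [ v ])

sumX : ∀ {n} → Rel n → List (Fin n × Fin n) → ℕ
sumX x es = sum (map (λ e → val (x (proj₁ e) (proj₂ e))) es)

unorderedPairs : ∀ n → List (Fin n × Fin n)
unorderedPairs n =
  filterᵇ (λ e → toℕ (proj₁ e) <ᵇ toℕ (proj₂ e))
          (concatMap (λ u → map (λ w → (u , w)) (allFin n)) (allFin n))

cutSum : ∀ {n} → Rel n → Rel n → (Fin n → Bool) → ℕ
cutSum {n} E x U =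
  sum (map (λ e → if E (proj₁ e) (proj₂ e) ∧ (U (proj₁ e) xor U (proj₂ e))
                  then 1 ∸ val (x (proj₁ e) (proj₂ e)) else 0)
           (unorderedPairs n))

-- x ∈ X_{G Ĝ}; x ∈ {0,1}^{E∪F} is represented by a Bool-valued function on
-- ordered pairs that is symmetric on E ∪ F (values off E ∪ F are irrelevant)
record InX {n} (E F : Rel n) (x : Rel n) : Set where
  field
    symm : ∀ (u w : Fin n) → (E u w ∨ F u w) ≡ true → x u w ≡ x w u
    cycleIneq : ∀ (v : Fin n) (vs : List (Fin n)) → IsCycle E v vs →
      ∀ (L₁ : List (Fin n × Fin n)) (e : Fin n × Fin n) (L₂ : List (Fin n × Fin n)) →
      cycleEdges v vs ≡ L₁ ++ e ∷ L₂ →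
      val (x (proj₁ e) (proj₂ e)) ≤ sumX x (L₁ ++ L₂)
    pathIneq : ∀ (u w : Fin n) → F u w ≡ true → ∀ (vs : List (Fin n)) → IsPath E u w vs →
      val (x u w) ≤ sumX x (pairs vs)
    cutIneq : ∀ (u w : Fin n) → F u w ≡ true → ∀ (U : Fin n → Bool) →
      U u ≡ true → U w ≡ false → 1 ∸ val (x u w) ≤ cutSum E x U

Connected : ∀ {n} → Rel n → Set
Connected {n} E = ∀ (u w : Fin n) → ∃ λ vs → IsPath E u w vs

InducedConnected : ∀ {n} → Rel n → (Fin n → Bool) → Set
InducedConnected {n} E U = ∀ (u w : Fin n) → U u ≡ true → U w ≡ true →
  ∃ λ vs → IsPath E u w vs × All (λ v → U v ≡ true) vs

PairwiseDisjoint : ∀ {m n} → (Fin m → Fin n → Bool) → Set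
PairwiseDisjoint {m} {n} A = ∀ (i j : Fin m) → i ≢ j → ∀ (v : Fin n) → A i v ≡ true → A j v ≡ false

xA : ∀ {m n} → (Fin m → Fin n → Bool) → Rel n
xA {m} A u w = not (any (λ i → A i u ∧ A i w) (allFin m))

-- Call a pair uw uncut when x^A_uw = 0.  Since the blocks in A are disjoint,
-- "equal or in a common block" is an equivalence relation, so the two ends of a
-- walk of uncut edges are equal or share a block; for distinct ends this makes
-- the pair itself uncut.  That gives the cycle and path inequalities.  For the
-- cut inequality, if x^A_uw = 0 then u and w lie in a block U₀ ∈ A, and a uw-path
-- inside the connected G[U₀] must cross the cut: the crossing edge has both ends
-- in U₀, so it is uncut and contributes 1 to the cut sum.
module Submission where

open import Defs
open import Data.Nat using (ℕ; zero; suc; _≤_; _∸_; z≤n; s≤s)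
open import Data.Nat.Properties using (≤-trans; m≤m+n; m≤n+m; m+n≡0⇒m≡0; m+n≡0⇒n≡0; <⇒<ᵇ)
open import Data.Nat.ListAction using (sum)
open import Data.Fin as Fin using (Fin)
open import Data.Fin.Properties using (<-cmp; _≟_)
open import Data.Bool using (Bool; true; false; _∧_; _xor_; not; if_then_else_)
open import Data.Bool.ListAction using (or)
open import Data.Bool.Properties using (T-≡; T-∧; ∧-comm; not-injective; xor-comm)
open import Data.List using (List; []; _∷_; _++_; [_]; allFin; last)
open import Data.List.Properties using (∷-injective; map-cong)
open import Data.List.Relation.Unary.All using (All; _∷_)
open import Data.List.Relation.Unary.Any using (here; there; satisfied)
open import Data.List.Relation.Unary.Any.Properties using (any⁺; any⁻)
open import Data.List.Relation.Unary.Linked using (Linked; _∷_)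
open import Data.List.Membership.Propositional using (_∈_; lose)
open import Data.List.Membership.Propositional.Properties
  using (∈-allFin; ∈-map⁺; ∈-++⁺ʳ; ∈-concatMap⁺; ∈-filter⁺)
open import Data.Maybe using (just)
open import Data.Maybe.Properties using (just-injective)
open import Data.Product using (∃; ∃₂; _×_; _,_; proj₁; proj₂)
import Data.List.Relation.Unary.Any as Any
open import Function using (_∘_)
open import Function.Bundles using (Equivalence)
open import Relation.Binary using (Transitive; _⇒_; tri<; tri≈; tri>)
open import Relation.Nullary using (yes; no; contradiction)
open import Relation.Binary.Construct.Closure.Reflexive as Refl using (ReflClosure)
import Relation.Binary.Construct.Closure.Reflexive.Properties as ReflClosure
open import Relation.Binary.Construct.Closure.ReflexiveTransitive using (Star; ε; _◅_; _◅◅_; fold)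
open import Relation.Binary.PropositionalEquality
  using (_≡_; _≢_; refl; sym; trans; subst; cong; cong₂; ≢-sym)

open Equivalence using (to; from)

val≤ : ∀ {b s} → (s ≡ 0 → b ≡ false) → val b ≤ s
val≤ {false}         _     = z≤n
val≤ {true} {zero}   s≡0⇒ with s≡0⇒ refl
... | ()
val≤ {true} {suc s}  _     = s≤s z≤n

1∸val≤ : ∀ {b s} → (b ≡ false → 1 ≤ s) → 1 ∸ val b ≤ s
1∸val≤ {true}  _ = z≤n
1∸val≤ {false} b≡false⇒ = b≡false⇒ refl

val≡0⇒≡false : ∀ {b} → val b ≡ 0 → b ≡ false
val≡0⇒≡false {false} _ = refl

∈⇒≤sum : ∀ {k ks} → k ∈ ks → k ≤ sum ks
∈⇒≤sum (here refl) = m≤m+n _ _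
∈⇒≤sum {ks = k ∷ _} (there k∈ks) = ≤-trans (∈⇒≤sum k∈ks) (m≤n+m _ k)

last-∷ʳ : ∀ {A : Set} (xs : List A) (v : A) → last (xs ++ [ v ]) ≡ just v
last-∷ʳ []           v = refl
last-∷ʳ (_ ∷ [])     v = refl
last-∷ʳ (_ ∷ y ∷ xs) v = last-∷ʳ (y ∷ xs) v

module _ {n : ℕ} where

  Linked⇒∈-pairs : ∀ {R : Fin n → Fin n → Set} {ws} → Linked R ws →
                   ∀ {a b} → (a , b) ∈ pairs ws → R a b
  Linked⇒∈-pairs (r ∷ _)  (here refl) = r
  Linked⇒∈-pairs (_ ∷ rs) (there p)   = Linked⇒∈-pairs rs p

  All⇒∈-pairs : ∀ {P : Fin n → Set} {ws} → All P ws →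
                ∀ {a b} → (a , b) ∈ pairs ws → P a × P b
  All⇒∈-pairs (pa ∷ pb ∷ _) (here refl) = pa , pb
  All⇒∈-pairs (_ ∷ ps@(_ ∷ _)) (there p) = All⇒∈-pairs ps p

  crossing-pair : (U : Fin n → Bool) (h : Fin n) (l : List (Fin n)) {t : Fin n} →
                  last (h ∷ l) ≡ just t → U h ≡ true → U t ≡ false →
                  ∃₂ λ a b → (a , b) ∈ pairs (h ∷ l) × U a ≡ true × U b ≡ false
  crossing-pair U h [] h≡t Uh Ut with just-injective h≡t
  ... | refl with trans (sym Uh) Ut
  ... | ()
  crossing-pair U h (b ∷ l) last≡t Uh Ut with U b in Ub
  ... | false = h , b , here refl , Uh , Ub
  ... | true  = let a , c , p , Ua , Uc = crossing-pair U b l last≡t Ub Ut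
                in  a , c , there p , Ua , Uc

  adjacent⇒distinct : ∀ {G : Rel n} → SimpleGraph G → ∀ {a b} → G a b ≡ true → a ≢ b
  adjacent⇒distinct (_ , irrefl) {a} Gab refl with trans (sym Gab) (irrefl a)
  ... | ()

module _ {n : ℕ} (x : Rel n) where

  Uncut : Fin n → Fin n → Set
  Uncut a b = x a b ≡ false

  uncut-walk : ∀ h l {t} → last (h ∷ l) ≡ just t →
               sumX x (pairs (h ∷ l)) ≡ 0 → Star Uncut h t
  uncut-walk h []      h≡t    _ = subst (Star Uncut h) (just-injective h≡t) ε
  uncut-walk h (b ∷ l) last≡t s =
    val≡0⇒≡false (m+n≡0⇒m≡0 _ s) ◅ uncut-walk b l last≡t (m+n≡0⇒n≡0 _ s)

  uncut-walk-split : ∀ h l {L₁ a b L₂ t} → pairs (h ∷ l) ≡ L₁ ++ (a , b) ∷ L₂ →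
                     last (h ∷ l) ≡ just t → sumX x (L₁ ++ L₂) ≡ 0 →
                     Star Uncut h a × Star Uncut b t
  uncut-walk-split h (c ∷ l) {[]}    refl last≡t s = ε , uncut-walk c l last≡t s
  uncut-walk-split h (c ∷ l) {_ ∷ _} eq   last≡t s with ∷-injective eq
  ... | refl , eq′ =
    let h⇝a , b⇝t = uncut-walk-split c l eq′ last≡t (m+n≡0⇒n≡0 _ s)
    in  val≡0⇒≡false (m+n≡0⇒m≡0 _ s) ◅ h⇝a , b⇝t

∈-unorderedPairs : ∀ {n} {a b : Fin n} → a Fin.< b → (a , b) ∈ unorderedPairs n
∈-unorderedPairs {n} {a} {b} a<b =
  ∈-filter⁺ _ (∈-concatMap⁺ _ (Any.map (λ { refl → ∈-map⁺ _ (∈-allFin b) }) (∈-allFin a)))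
             (<⇒<ᵇ a<b)

cutSum-positive : ∀ {n} (E x : Rel n) (U : Fin n → Bool) {a b} → a Fin.< b →
                  E a b ≡ true → (U a xor U b) ≡ true → x a b ≡ false → 1 ≤ cutSum E x U
cutSum-positive E x U {a} {b} a<b Eab Uab xab =
  subst (_≤ cutSum E x U) term≡1 (∈⇒≤sum (∈-map⁺ _ (∈-unorderedPairs a<b)))
  where
  term≡1 : (if E a b ∧ (U a xor U b) then 1 ∸ val (x a b) else 0) ≡ 1
  term≡1 rewrite Eab | Uab | xab = refl

-- unorderedPairs lists each edge in one orientation only, hence the case split.
crossing-uncut-edge⇒cutSum-positive :
  ∀ {n} (E x : Rel n) (U : Fin n → Bool) → SimpleGraph E → ∀ {a b} →
  E a b ≡ true → U a ≡ true → U b ≡ false → x a b ≡ false → x b a ≡ false →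
  1 ≤ cutSum E x U
crossing-uncut-edge⇒cutSum-positive E x U E-simple {a} {b} Eab Ua Ub xab xba
  with <-cmp a b
... | tri< a<b _ _ = cutSum-positive E x U a<b Eab Uab xab
  where Uab = cong₂ _xor_ Ua Ub
... | tri≈ _ a≡b _ = contradiction a≡b (adjacent⇒distinct E-simple Eab)
... | tri> _ _ b<a = cutSum-positive E x U b<a (trans (proj₁ E-simple b a) Eab) Uba xba
  where Uba = trans (xor-comm (U b) (U a)) (cong₂ _xor_ Ua Ub)

module _ {m n : ℕ} (A : Fin m → Fin n → Bool) where

  SameBlock : Fin n → Fin n → Set
  SameBlock a b = ∃ λ i → A i a ≡ true × A i b ≡ true

  SameBlock-trans : PairwiseDisjoint A → Transitive SameBlock
  SameBlock-trans disjoint {j = b} (i , Aia , Aib) (j , Ajb , Ajc) with i ≟ j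
  ... | yes refl = i , Aia , Ajc
  ... | no  i≢j  with trans (sym (disjoint i j i≢j b Aib)) Ajb
  ...   | ()

  xA-sym : ∀ {a b} → xA A a b ≡ xA A b a
  xA-sym {a} {b} = cong (not ∘ or) (map-cong (λ i → ∧-comm (A i a) (A i b)) (allFin m))

  SameBlock⇒xA≡false : ∀ {a b} → SameBlock a b → xA A a b ≡ false
  SameBlock⇒xA≡false (i , Aia , Aib) =
    cong not (to T-≡ (any⁺ _ (lose (∈-allFin i) (from T-∧ (from T-≡ Aia , from T-≡ Aib)))))

  xA≡false⇒SameBlock : ∀ {a b} → xA A a b ≡ false → SameBlock a b
  xA≡false⇒SameBlock xab≡false =
    let i , Tab  = satisfied (any⁻ _ (allFin m) (from T-≡ (not-injective xab≡false)))
        Ta , Tb  = to T-∧ Tab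
    in  i , to T-≡ Ta , to T-≡ Tb

  ReflClosure-SameBlock⇒xA≡false : ∀ {a b} → a ≢ b → ReflClosure SameBlock a b → xA A a b ≡ false
  ReflClosure-SameBlock⇒xA≡false a≢b Refl.refl     = contradiction refl a≢b
  ReflClosure-SameBlock⇒xA≡false _   Refl.[ same ] = SameBlock⇒xA≡false same

  module _ (disjoint : PairwiseDisjoint A) where

    uncut-walk⇒ReflClosure-SameBlock : Star (Uncut (xA A)) ⇒ ReflClosure SameBlock
    uncut-walk⇒ReflClosure-SameBlock = fold (ReflClosure SameBlock)
      (λ xab → ReflClosure.trans (SameBlock-trans disjoint) Refl.[ xA≡false⇒SameBlock xab ]) Refl.refl

    uncut-walk⇒xA≡false : ∀ {a b} → a ≢ b → Star (Uncut (xA A)) a b → xA A a b ≡ false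
    uncut-walk⇒xA≡false a≢b = ReflClosure-SameBlock⇒xA≡false a≢b ∘ uncut-walk⇒ReflClosure-SameBlock

    xA-cycleIneq : ∀ {E : Rel n} → SimpleGraph E → ∀ v vs → IsCycle E v vs →
                   ∀ L₁ e L₂ → cycleEdges v vs ≡ L₁ ++ e ∷ L₂ →
                   val (xA A (proj₁ e) (proj₂ e)) ≤ sumX (xA A) (L₁ ++ L₂)
    xA-cycleIneq E-simple v vs (_ , _ , linked) L₁ (a , b) L₂ eq = val≤ λ rest≡0 →
      let v⇝a , b⇝v = uncut-walk-split (xA A) v (vs ++ [ v ]) eq (last-∷ʳ (v ∷ vs) v) rest≡0
          Eab       = Linked⇒∈-pairs linked (subst ((a , b) ∈_) (sym eq) (∈-++⁺ʳ L₁ (here refl)))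
      in  trans xA-sym (uncut-walk⇒xA≡false (≢-sym (adjacent⇒distinct E-simple Eab)) (b⇝v ◅◅ v⇝a))

    xA-pathIneq : ∀ {E : Rel n} {u w} → u ≢ w → ∀ vs → IsPath E u w vs →
                  val (xA A u w) ≤ sumX (xA A) (pairs vs)
    xA-pathIneq u≢w []      (() , _)
    xA-pathIneq u≢w (h ∷ l) (h≡u , last≡w , _) with just-injective h≡u
    ... | refl = val≤ λ s≡0 → uncut-walk⇒xA≡false u≢w (uncut-walk (xA A) h l last≡w s≡0)

  block-path⇒cutSum-positive : ∀ {E : Rel n} → SimpleGraph E → ∀ i U {u w} → U u ≡ true → U w ≡ false →
                               ∃ (λ vs → IsPath E u w vs × All (λ v → A i v ≡ true) vs) →
                               1 ≤ cutSum E (xA A) U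
  block-path⇒cutSum-positive E-simple i U Uu Uw ([] , (() , _) , _)
  block-path⇒cutSum-positive {E} E-simple i U Uu Uw ((h ∷ l) , (h≡u , last≡w , _ , linked) , inBlock)
    with just-injective h≡u
  ... | refl =
    let a , b , ab∈ , Ua , Ub = crossing-pair U h l last≡w Uu Uw
        Aia , Aib             = All⇒∈-pairs inBlock ab∈
    in  crossing-uncut-edge⇒cutSum-positive E (xA A) U E-simple (Linked⇒∈-pairs linked ab∈) Ua Ub
          (SameBlock⇒xA≡false (i , Aia , Aib)) (SameBlock⇒xA≡false (i , Aib , Aia))

lemma1 : ∀ {n : ℕ} (E F : Rel n) → SimpleGraph E → SimpleGraph F → EdgeDisjoint E F →
           Connected E →
           ∀ {m : ℕ} (A : Fin m → Fin n → Bool) → PairwiseDisjoint A →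
           (∀ (i : Fin m) → InducedConnected E (A i)) →
           InX E F (xA A)
lemma1 E F E-simple F-simple _ _ A disjoint blocks-connected = record
  { symm      = λ _ _ _ → xA-sym A
  ; cycleIneq = xA-cycleIneq A disjoint E-simple
  ; pathIneq  = λ u w Fuw → xA-pathIneq A disjoint (adjacent⇒distinct F-simple Fuw)
  ; cutIneq   = λ u w _ U Uu Uw → 1∸val≤ λ xuw≡false →
      let i , Aiu , Aiw = xA≡false⇒SameBlock A xuw≡false
      in  block-path⇒cutSum-positive A E-simple i U Uu Uw (blocks-connected i u w Aiu Aiw)
  }
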